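{- Let $\mathbf{D}$ be a D-core algebra and $x,y\in D$. Then (1a) $x\sqcap(x\vee y)=x\sqcap x$ and (1b) $x\sqcup(x\wedge y)=x\sqcup x$.
   Context: Write $x\vee y:=\neg(\neg x\sqcap\neg y)$ and $x\wedge y:=\lrcorner(\lrcorner x\sqcup\lrcorner y)$. A D-core algebra is an algebra $(D;\sqcap,\sqcup,\neg,\lrcorner,\top,\bot)$ of type $(2,2,1,1,0,0)$ satisfying, for all $x,y,z\in D$: $x\sqcap y=y\sqcap x$; $x\sqcup y=y\sqcup x$; $\neg(x\sqcap x)=\neg x$; $\lrcorner(x\sqcup x)=\lrcorner x$; $x\sqcap(x\sqcup y)=x\sqcap x$; $x\sqcup(x\sqcap y)=x\sqcup x$; $x\sqcap(y\vee z)=(x\sqcap y)\vee(x\sqcap z)$; $x\sqcup(y\wedge z)=(x\sqcup y)\wedge(x\sqcup z)$; $\neg\neg(x\sqcap y)=x\sqcap y$; $\lrcorner\lrcorner(x\sqcup y)=x\sqcup y$; $x\sqcap\neg x=\bot$; $x\sqcup\lrcorner x=\top$; $(x\sqcap x)\sqcup(x\sqcap x)=(x\sqcup x)\sqcap(x\sqcup x)$. -}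

module Defs where

open import Level using (Level; suc)
open import Relation.Binary.PropositionalEquality using (_≡_)

record DCoreAlgebra (a : Level) : Set (suc a) where
  infixr 7 _⊓_
  infixr 6 _⊔_
  field
    D    : Set a
    _⊓_  : D → D → D
    _⊔_  : D → D → D
    ¬_   : D → D
    ⌟_   : D → D
    ⊤    : D
    ⊥    : D

  _∨_ : D → D → D
  x ∨ y = ¬ ((¬ x) ⊓ (¬ y))

  _∧_ : D → D → D
  x ∧ y = ⌟ ((⌟ x) ⊔ (⌟ y))

  field
    ⊓-comm      : ∀ x y → x ⊓ y ≡ y ⊓ x
    ⊔-comm      : ∀ x y → x ⊔ y ≡ y ⊔ x
    ¬-⊓-idem    : ∀ x → ¬ (x ⊓ x) ≡ ¬ x
    ⌟-⊔-idem    : ∀ x → ⌟ (x ⊔ x) ≡ ⌟ x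
    ⊓-absorb    : ∀ x y → x ⊓ (x ⊔ y) ≡ x ⊓ x
    ⊔-absorb    : ∀ x y → x ⊔ (x ⊓ y) ≡ x ⊔ x
    ⊓-distrib-∨ : ∀ x y z → x ⊓ (y ∨ z) ≡ (x ⊓ y) ∨ (x ⊓ z)
    ⊔-distrib-∧ : ∀ x y z → x ⊔ (y ∧ z) ≡ (x ⊔ y) ∧ (x ⊔ z)
    ¬¬-⊓        : ∀ x y → ¬ (¬ (x ⊓ y)) ≡ x ⊓ y
    ⌟⌟-⊔        : ∀ x y → ⌟ (⌟ (x ⊔ y)) ≡ x ⊔ y
    ⊓-¬         : ∀ x → x ⊓ (¬ x) ≡ ⊥
    ⊔-⌟         : ∀ x → x ⊔ (⌟ x) ≡ ⊤
    ⊓⊔-swap     : ∀ x → (x ⊓ x) ⊔ (x ⊓ x) ≡ (x ⊔ x) ⊓ (x ⊔ x)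

{-# OPTIONS --safe #-}
module Submission where

-- Distributivity lets x ⊓ x be traded for x ⊓ ⊤ inside a join, so
-- x ⊓ (x ∨ y) = x ⊓ (⊤ ∨ y).  Since ¬ ⊤ = ⊥ is absorbing for ⊓, ⊤ ∨ y
-- collapses to ¬ ⊥ = ⊤ ∨ ⊤, and x ⊓ (⊤ ∨ ⊤) = x ⊓ x.  Part (1b) is (1a)
-- in the dual algebra, which swaps ⊓ with ⊔, ¬ with ⌟ and ⊤ with ⊥.

open import Defs
open import Level using (Level)
open import Data.Product using (_×_; _,_)
open import Relation.Binary.PropositionalEquality
  using (_≡_; sym; trans; cong; cong₂; module ≡-Reasoning)

module Properties {a : Level} (A : DCoreAlgebra a) where
  open DCoreAlgebra A
  open ≡-Reasoning

  ¬¬x≡x⊓x : ∀ x → ¬ (¬ x) ≡ x ⊓ x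
  ¬¬x≡x⊓x x = trans (cong ¬_ (sym (¬-⊓-idem x))) (¬¬-⊓ x x)

  ¬¬¬x≡¬x : ∀ x → ¬ (¬ (¬ x)) ≡ ¬ x
  ¬¬¬x≡¬x x = trans (cong ¬_ (¬¬x≡x⊓x x)) (¬-⊓-idem x)

  ¬¬-fixed⇒⊓-idem : ∀ {z} → ¬ (¬ z) ≡ z → z ⊓ z ≡ z
  ¬¬-fixed⇒⊓-idem {z} ¬¬z≡z = trans (sym (¬¬x≡x⊓x z)) ¬¬z≡z

  ¬x⊓¬x≡¬x : ∀ x → (¬ x) ⊓ (¬ x) ≡ ¬ x
  ¬x⊓¬x≡¬x x = ¬¬-fixed⇒⊓-idem (¬¬¬x≡¬x x)

  [x⊓y]⊓[x⊓y]≡x⊓y : ∀ x y → (x ⊓ y) ⊓ (x ⊓ y) ≡ x ⊓ y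
  [x⊓y]⊓[x⊓y]≡x⊓y x y = ¬¬-fixed⇒⊓-idem (¬¬-⊓ x y)

  ∨-comm : ∀ x y → x ∨ y ≡ y ∨ x
  ∨-comm x y = cong ¬_ (⊓-comm (¬ x) (¬ y))

  ∨-idem : ∀ x → x ∨ x ≡ x ⊓ x
  ∨-idem x = trans (cong ¬_ (¬x⊓¬x≡¬x x)) (¬¬x≡x⊓x x)

  x⊓⊤≡x⊓x : ∀ x → x ⊓ ⊤ ≡ x ⊓ x
  x⊓⊤≡x⊓x x = trans (cong (x ⊓_) (sym (⊔-⌟ x))) (⊓-absorb x (⌟ x))

  ¬⊤≡⊥ : ¬ ⊤ ≡ ⊥
  ¬⊤≡⊥ = begin
    ¬ ⊤             ≡⟨ sym (¬x⊓¬x≡¬x ⊤) ⟩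
    (¬ ⊤) ⊓ (¬ ⊤)   ≡⟨ sym (x⊓⊤≡x⊓x (¬ ⊤)) ⟩
    (¬ ⊤) ⊓ ⊤       ≡⟨ ⊓-comm (¬ ⊤) ⊤ ⟩
    ⊤ ⊓ (¬ ⊤)       ≡⟨ ⊓-¬ ⊤ ⟩
    ⊥               ∎

  x⊓¬⊥≡x⊓x : ∀ x → x ⊓ (¬ ⊥) ≡ x ⊓ x
  x⊓¬⊥≡x⊓x x = begin
    x ⊓ (¬ ⊥)                  ≡⟨ cong (λ w → x ⊓ (¬ w)) (sym ¬⊤≡⊥) ⟩
    x ⊓ (¬ (¬ ⊤))              ≡⟨ cong (x ⊓_) (sym (¬-⊓-idem (¬ ⊤))) ⟩
    x ⊓ (⊤ ∨ ⊤)                ≡⟨ ⊓-distrib-∨ x ⊤ ⊤ ⟩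
    (x ⊓ ⊤) ∨ (x ⊓ ⊤)          ≡⟨ cong₂ _∨_ (x⊓⊤≡x⊓x x) (x⊓⊤≡x⊓x x) ⟩
    (x ⊓ x) ∨ (x ⊓ x)          ≡⟨ ∨-idem (x ⊓ x) ⟩
    (x ⊓ x) ⊓ (x ⊓ x)          ≡⟨ [x⊓y]⊓[x⊓y]≡x⊓y x x ⟩
    x ⊓ x                      ∎

  x∨⊥≡x⊓x : ∀ x → x ∨ ⊥ ≡ x ⊓ x
  x∨⊥≡x⊓x x = begin
    ¬ ((¬ x) ⊓ (¬ ⊥))   ≡⟨ cong ¬_ (x⊓¬⊥≡x⊓x (¬ x)) ⟩
    ¬ ((¬ x) ⊓ (¬ x))   ≡⟨ ∨-idem x ⟩
    x ⊓ x               ∎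

  ⊓-zeroʳ : ∀ x → x ⊓ ⊥ ≡ ⊥
  ⊓-zeroʳ x = begin
    x ⊓ ⊥                      ≡⟨ sym ([x⊓y]⊓[x⊓y]≡x⊓y x ⊥) ⟩
    (x ⊓ ⊥) ⊓ (x ⊓ ⊥)          ≡⟨ sym (x∨⊥≡x⊓x (x ⊓ ⊥)) ⟩
    (x ⊓ ⊥) ∨ ⊥                ≡⟨ cong ((x ⊓ ⊥) ∨_) (sym (⊓-¬ x)) ⟩
    (x ⊓ ⊥) ∨ (x ⊓ (¬ x))      ≡⟨ sym (⊓-distrib-∨ x ⊥ (¬ x)) ⟩
    x ⊓ (⊥ ∨ (¬ x))            ≡⟨ cong (x ⊓_) (∨-comm ⊥ (¬ x)) ⟩
    x ⊓ ((¬ x) ∨ ⊥)            ≡⟨ cong (x ⊓_) (x∨⊥≡x⊓x (¬ x)) ⟩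
    x ⊓ ((¬ x) ⊓ (¬ x))        ≡⟨ cong (x ⊓_) (¬x⊓¬x≡¬x x) ⟩
    x ⊓ (¬ x)                  ≡⟨ ⊓-¬ x ⟩
    ⊥                          ∎

  ⊤∨y≡¬⊥ : ∀ y → ⊤ ∨ y ≡ ¬ ⊥
  ⊤∨y≡¬⊥ y = begin
    ¬ ((¬ ⊤) ⊓ (¬ y))   ≡⟨ cong (λ w → ¬ (w ⊓ (¬ y))) ¬⊤≡⊥ ⟩
    ¬ (⊥ ⊓ (¬ y))       ≡⟨ cong ¬_ (⊓-comm ⊥ (¬ y)) ⟩
    ¬ ((¬ y) ⊓ ⊥)       ≡⟨ cong ¬_ (⊓-zeroʳ (¬ y)) ⟩
    ¬ ⊥                 ∎

  ⊓-∨-absorb : ∀ x y → x ⊓ (x ∨ y) ≡ x ⊓ x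
  ⊓-∨-absorb x y = begin
    x ⊓ (x ∨ y)         ≡⟨ ⊓-distrib-∨ x x y ⟩
    (x ⊓ x) ∨ (x ⊓ y)   ≡⟨ cong (_∨ (x ⊓ y)) (sym (x⊓⊤≡x⊓x x)) ⟩
    (x ⊓ ⊤) ∨ (x ⊓ y)   ≡⟨ sym (⊓-distrib-∨ x ⊤ y) ⟩
    x ⊓ (⊤ ∨ y)         ≡⟨ cong (x ⊓_) (⊤∨y≡¬⊥ y) ⟩
    x ⊓ (¬ ⊥)           ≡⟨ x⊓¬⊥≡x⊓x x ⟩
    x ⊓ x               ∎

dual : ∀ {a : Level} → DCoreAlgebra a → DCoreAlgebra a
dual A = record
  { D = D ; _⊓_ = _⊔_ ; _⊔_ = _⊓_ ; ¬_ = ⌟_ ; ⌟_ = ¬_ ; ⊤ = ⊥ ; ⊥ = ⊤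
  ; ⊓-comm = ⊔-comm ; ⊔-comm = ⊓-comm
  ; ¬-⊓-idem = ⌟-⊔-idem ; ⌟-⊔-idem = ¬-⊓-idem
  ; ⊓-absorb = ⊔-absorb ; ⊔-absorb = ⊓-absorb
  ; ⊓-distrib-∨ = ⊔-distrib-∧ ; ⊔-distrib-∧ = ⊓-distrib-∨
  ; ¬¬-⊓ = ⌟⌟-⊔ ; ⌟⌟-⊔ = ¬¬-⊓
  ; ⊓-¬ = ⊔-⌟ ; ⊔-⌟ = ⊓-¬
  ; ⊓⊔-swap = λ x → sym (⊓⊔-swap x)
  }
  where open DCoreAlgebra A

theorem3p8 : ∀ {a : Level} (A : DCoreAlgebra a) → let open DCoreAlgebra A in ∀ (x y : D) → ((x ⊓ (x ∨ y)) ≡ (x ⊓ x)) × ((x ⊔ (x ∧ y)) ≡ (x ⊔ x))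
theorem3p8 A x y = Properties.⊓-∨-absorb A x y , Properties.⊓-∨-absorb (dual A) x y
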